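{- Let $\mathcal{M}$ be a Minsky machine satisfying the standing assumptions below and let $R\le\mathbb{A}(\mathcal{M})^m$ be computational and non-halting. If $t$ is a $k$-ary term operation of $\mathbb{A}(\mathcal{M})$ and $\bar r\in R^k$ is such that $t(\bar r)\in Y^m$, then either (1) $t(\bar r)\in R_I$, or (2) there is a term operation $s$ without the operation $I$ in its term tree such that $s(\bar r)=t(\bar r)$.
   Context: Minsky machines. A Minsky machine $\mathcal{M}$ has states $\{0,1,\dots,N\}$ ($0$ is the halting state, $1$ the initial state), two registers $A,B$ holding values in $\mathbb{N}$, and a finite set of instructions of the forms $(i,R,j)$ and $(i,R,k,j)$ with $R\in\{A,B\}$. It acts on configurations $(s,\alpha,\beta)\in\{0,\dots,N\}\times\mathbb{N}\times\mathbb{N}$: $\mathcal{M}(i,\alpha,\beta)$ is $(j,\alpha+1,\beta)$ if $(i,A,j)\in\mathcal{M}$; $(j,\alpha,\beta+1)$ if $(i,B,j)\in\mathcal{M}$; $(j,\alpha-1,\beta)$ if $(i,A,k,j)\in\mathcal{M}$ and $\alpha\neq0$; $(j,\alpha,\beta-1)$ if $(i,B,k,j)\in\mathcal{M}$ and $\beta\ne 0$; $(k,\alpha,\beta)$ if $(i,A,k,j)\in\mathcal{M}$ and $\alpha=0$, or $(i,B,k,j)\in\mathcal{M}$ and $\beta=0$; and $(0,\alpha,\beta)$ if $i=0$. $\mathcal{M}$ halts if $\mathcal{M}^n(1,0,0)$ has state $0$ for some $n$. Standing assumptions on $\mathcal{M}$: it returns both registers to $0$ before halting; it has exactly one instruction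 $(i,\dots)$ for each non-halting state $i$; the instruction for state $1$ has the form $(1,R,s)$; in the state graph (vertices the states, an edge $i\to j$ iff $\mathcal{M}(i,\alpha,\beta)=(j,\alpha',\beta')$ for some $\alpha,\beta,\alpha',\beta'$) every state is reachable from $1$ and $0$ is reachable from every state; and $\mathcal{M}$ halts with capacity $\kappa$ (it halts and $\alpha+\beta\le\kappa$ whenever $\mathcal{M}^n(1,0,0)=(i,\alpha,\beta)$). The algebra. $A(\mathcal{M})=\{\langle i,c\rangle: 0\le i\le N,\ c\in\{\bullet,\times,0,A,B\}\}$. Put $X=\{\langle i,\times\rangle\}$, $D=\{\langle i,\bullet\rangle\}$, $C=A(\mathcal{M})\setminus(X\cup D)$, $Y=A(\mathcal{M})\setminus X$; $\mathrm{X}(\langle i,c\rangle)=\langle i,\times\rangle$, $\mathrm{State}(\langle i,c\rangle)=i$, $\mathrm{Content}(\langle i,c\rangle)=c$. Write "$(i,R,\dots,j)\in\mathcal{M}$" to mean $(i,R,j)\in\mathcal{M}$ or $(i,R,k,j)\in\mathcal{M}$ for some $k$. The operations (cases read in order, first applicable case applies): $\langle i,c\rangle\wedge\langle j,d\rangle$ is $\langle i,c\rangle$ if the two are equal, else $\langle\min(i,j),\times\rangle$. $M(x,y)$: $\langle j,R\rangle$ if $x=\langle i,\bullet\rangle, y=\langle i,0\rangle,(i,R,j)\in\mathcal{M}$; $\langle j,0\rangle$ if $x=\langle i,\bullet\rangle,y=\langle i,R\rangle,(i,R,k,j)\in\mathcal{M}$; $\langle j,\bullet\rangle$ if $x=\langle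 i,0\rangle,y=\langle i,\bullet\rangle,(i,R,j)\in\mathcal{M}$; $\langle j,\bullet\rangle$ if $x=\langle i,R\rangle,y=\langle i,\bullet\rangle,(i,R,k,j)\in\mathcal{M}$; $\langle j,c\rangle$ if $x=y=\langle i,c\rangle$, $c\ne\bullet$, $(i,R,\dots,j)\in\mathcal{M}$; $\langle j,\times\rangle$ if $\mathrm{State}(x)=\mathrm{State}(y)=i$ and $(i,R,\dots,j)\in\mathcal{M}$; otherwise $\mathrm{X}(y)$. $M'(x)$: $\langle k,c\rangle$ if $x=\langle i,c\rangle$, $(i,R,k,j)\in\mathcal{M}$, $c\neq R$; $\langle k,\times\rangle$ if $\mathrm{State}(x)=i$ and $(i,R,k,j)\in\mathcal{M}$; otherwise $\mathrm{X}(x)$. $I(x,y)$: $\langle1,\bullet\rangle$ if $x\in D$; $\langle 1,0\rangle$ if $y\in C$; otherwise $\langle1,\times\rangle$. $H(x)$: $\langle0,0\rangle$ if $x\in\{\langle0,0\rangle,\langle0,\bullet\rangle\}$, otherwise $\langle0,\times\rangle$. $N_0(x,y,z)$: $y$ if $x=\langle0,\bullet\rangle$ and $\mathrm{State}(y)=\mathrm{State}(z)$; $z$ if $x=\langle0,0\rangle$, $z\notin D$, $\mathrm{State}(y)=\mathrm{State}(z)$; otherwise $\mathrm{X}(y\wedge z)$. $S(x,y,z)$: $\langle1,0\rangle$ if $x=\langle1,0\rangle$, $\mathrm{State}(y)=\mathrm{State}(z)=1$ and $(\mathrm{Content}(y),\mathrm{Content}(z))\in\{(\bullet,0),(0,\bullet),(0,0)\}$;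 otherwise $\langle1,\times\rangle$. $N_\bullet(u,x,y,z)$, where the first four cases require $\mathrm{State}(x)=\mathrm{State}(y)=\mathrm{State}(z)$: $x$ if $x=y\notin X$; $x$ if $u\in D$, $y\in X$; $y$ if $u\in D$, $x\in X$; $z$ if $u\in D$, $z\in\{x,y\}$; otherwise $\mathrm{X}(x\wedge y\wedge z)$. $P(u,v,x,y)$: $x$ if $\mathrm{State}(u)=\mathrm{State}(v)$, else $y$. $\mathbb{A}(\mathcal{M})=\langle A(\mathcal{M});\wedge,M,M',I,H,N_0,S,N_\bullet,P\rangle$; operations act coordinatewise on powers; $R\le\mathbb{A}(\mathcal{M})^m$ means $R$ is a subuniverse of $A(\mathcal{M})^m$. A term operation "without $I$ in its term tree" is one expressible as a composition of projections and the fundamental operations other than $I$. Relation notions. A tuple is synchronized if its entries all have the same state. $R$ is computational if all its elements are synchronized and each has at most one coordinate in $D$. $R$ is halting if it contains some $r\in\{\langle0,0\rangle,\langle0,\bullet\rangle\}^m\setminus\{\langle0,0\rangle\}^m$, non-halting otherwise. $R_I$ is the subuniverse of $A(\mathcal{M})^m$ generated by $\{I(a,b):a,b\in R\cap Y^m\}$. Standing assumption: the subalgebra of $\mathbb{A}(\mathcal{M})$ generated by $\{\langle1,\bullet\rangle,\langle1,0\rangle\}$ contains $\langle0,\bullet\rangle$. -}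

module Defs where

open import Data.Nat using (ℕ; zero; suc; _+_; _≤_; _≤ᵇ_)
open import Data.Fin using (Fin; zero; suc; toℕ)
open import Data.Fin.Properties using () renaming (_≟_ to _≟F_)
open import Data.Bool using (Bool; true; false; if_then_else_; _∧_; _∨_; not)
open import Data.Product using (Σ; ∃; ∃₂; _×_; _,_; proj₁; proj₂)
open import Data.Sum using (_⊎_)
open import Data.Vec using (Vec; lookup; tabulate; [_])
open import Data.Maybe using (Maybe; just; nothing)
open import Relation.Nullary using (¬_)
open import Relation.Nullary.Decidable using (⌊_⌋)
open import Relation.Binary.PropositionalEquality using (_≡_)
open import Relation.Binary.Construct.Closure.ReflexiveTransitive using (Star)

-- A machine with N = suc n non-halting states has states
-- Fin (suc (suc n)) = {0,1,...,N}; 0 is halting, 1 (= suc zero) initial.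
-- The standing assumption "exactly one instruction (i,...) for each
-- non-halting state i" is built in: the instruction of state suc i is M i.

data Reg : Set where
  rA rB : Reg

-- inc R j  is the instruction (i,R,j)
-- dec R k j  is the instruction (i,R,k,j)
data Instr (n : ℕ) : Set where
  inc : Reg → Fin (suc (suc n)) → Instr n
  dec : Reg → Fin (suc (suc n)) → Fin (suc (suc n)) → Instr n

Machine : ℕ → Set
Machine n = Fin (suc n) → Instr n

Config : ℕ → Set
Config n = Fin (suc (suc n)) × ℕ × ℕ

exec : ∀ {n} → Instr n → ℕ → ℕ → Config n
exec (inc rA j) a b = j , suc a , b
exec (inc rB j) a b = j , a , suc b
exec (dec rA k j) zero b = k , zero , b
exec (dec rA k j) (suc a) b = j , a , b
exec (dec rB k j) a zero = k , a , zero
exec (dec rB k j) a (suc b) = j , a , b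

step : ∀ {n} → Machine n → Config n → Config n
step M (zero , a , b) = zero , a , b
step M (suc i , a , b) = exec (M i) a b

run : ∀ {n} → Machine n → ℕ → Config n → Config n
run M zero c = c
run M (suc t) c = step M (run M t c)

initial : ∀ {n} → Config n
initial = suc zero , 0 , 0

Halts : ∀ {n} → Machine n → Set
Halts M = ∃ λ t → proj₁ (run M t initial) ≡ zero

HaltsWithCapacity : ∀ {n} → Machine n → ℕ → Set
HaltsWithCapacity M κ =
  Halts M × (∀ t → proj₁ (proj₂ (run M t initial)) + proj₂ (proj₂ (run M t initial)) ≤ κ)

Edge : ∀ {n} → Machine n → Fin (suc (suc n)) → Fin (suc (suc n)) → Set
Edge M i j = ∃ λ α → ∃ λ β → ∃ λ α' → ∃ λ β' → step M (i , α , β) ≡ (j , α' , β')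

data Content : Set where
  dot crs zro cA cB : Content   -- •, ×, 0, A, B

creg : Reg → Content
creg rA = cA
creg rB = cB

eqC : Content → Content → Bool
eqC dot dot = true
eqC crs crs = true
eqC zro zro = true
eqC cA cA = true
eqC cB cB = true
eqC _ _ = false

-- terms in k variables over the signature (∧, M, M', I, H, N₀, S, N•, P)
data Term (k : ℕ) : Set where
  var : Fin k → Term k
  tMeet tM tI : Term k → Term k → Term k
  tM' tH : Term k → Term k
  tN0 tS : Term k → Term k → Term k → Term k
  tNd tP : Term k → Term k → Term k → Term k → Term k

data NoI {k : ℕ} : Term k → Set where
  nVar : ∀ i → NoI (var i)
  nMeet : ∀ {s t} → NoI s → NoI t → NoI (tMeet s t)
  nM : ∀ {s t} → NoI s → NoI t → NoI (tM s t)
  nM' : ∀ {s} → NoI s → NoI (tM' s)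
  nH : ∀ {s} → NoI s → NoI (tH s)
  nN0 : ∀ {s t u} → NoI s → NoI t → NoI u → NoI (tN0 s t u)
  nS : ∀ {s t u} → NoI s → NoI t → NoI u → NoI (tS s t u)
  nNd : ∀ {s t u v} → NoI s → NoI t → NoI u → NoI v → NoI (tNd s t u v)
  nP : ∀ {s t u v} → NoI s → NoI t → NoI u → NoI v → NoI (tP s t u v)

module Alg {n : ℕ} (M : Machine n) where

  St : Set
  St = Fin (suc (suc n))

  A : Set
  A = St × Content

  one : St
  one = suc zero

  state : A → St
  state = proj₁

  content : A → Content
  content = proj₂

  eqF : St → St → Bool
  eqF i j = ⌊ i ≟F j ⌋

  eqA : A → A → Bool
  eqA (i , c) (j , d) = eqF i j ∧ eqC c d

  Xf : A → A
  Xf (i , c) = i , crs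

  isD isX isC : A → Bool
  isD x = eqC (content x) dot
  isX x = eqC (content x) crs
  isC x = not (isD x) ∧ not (isX x)

  minF : St → St → St
  minF i j = if toℕ i ≤ᵇ toℕ j then i else j

  _⊓_ : A → A → A
  x ⊓ y = if eqA x y then x else (minF (state x) (state y) , crs)

  ins : St → Maybe (Instr n)
  ins zero = nothing
  ins (suc i) = just (M i)

  nxt : Instr n → St
  nxt (inc R j) = j
  nxt (dec R k j) = j

  same : Content → Content → Content
  same c d = if eqC c d ∧ not (eqC c dot) then c else crs

  Mc : Instr n → Content → Content → Content
  Mc (inc R j) dot zro = creg R
  Mc (inc R j) zro dot = dot
  Mc (inc R j) c d = same c d
  Mc (dec R k j) dot d = if eqC d (creg R) then zro else same dot d
  Mc (dec R k j) c dot = if eqC c (creg R) then dot else same c dot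
  Mc (dec R k j) c d = same c d

  opMaux : Maybe (Instr n) → A → A → A
  opMaux nothing x y = Xf y
  opMaux (just ι) x y = nxt ι , Mc ι (content x) (content y)

  opM : A → A → A
  opM x y = if eqF (state x) (state y) then opMaux (ins (state x)) x y else Xf y

  opM'aux : Maybe (Instr n) → A → A
  opM'aux (just (dec R k j)) (i , c) = k , (if eqC c (creg R) then crs else c)
  opM'aux _ x = Xf x

  opM' : A → A
  opM' x = opM'aux (ins (state x)) x

  opI : A → A → A
  opI x y = if isD x then (one , dot) else (if isC y then (one , zro) else (one , crs))

  opH : A → A
  opH x = if eqA x (zero , zro) ∨ eqA x (zero , dot) then (zero , zro) else (zero , crs)

  opN0 : A → A → A → A
  opN0 x y z =
    if eqA x (zero , dot) ∧ eqF (state y) (state z) then y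
    else (if eqA x (zero , zro) ∧ not (isD z) ∧ eqF (state y) (state z) then z
    else Xf (y ⊓ z))

  okPair : Content → Content → Bool
  okPair dot zro = true
  okPair zro dot = true
  okPair zro zro = true
  okPair _ _ = false

  opS : A → A → A → A
  opS x y z =
    if eqA x (one , zro) ∧ eqF (state y) one ∧ eqF (state z) one ∧ okPair (content y) (content z)
    then (one , zro) else (one , crs)

  opNd : A → A → A → A → A
  opNd u x y z =
    if eqF (state x) (state y) ∧ eqF (state y) (state z)
    then (if eqA x y ∧ not (isX x) then x
      else (if isD u ∧ isX y then x
      else (if isD u ∧ isX x then y
      else (if isD u ∧ (eqA z x ∨ eqA z y) then z
      else Xf ((x ⊓ y) ⊓ z)))))
    else Xf ((x ⊓ y) ⊓ z)

  opP : A → A → A → A → A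
  opP u v x y = if eqF (state u) (state v) then x else y

  Tup : ℕ → Set
  Tup m = Vec A m

  module _ {m : ℕ} where
    lift1 : (A → A) → Tup m → Tup m
    lift1 f u = tabulate (λ c → f (lookup u c))

    lift2 : (A → A → A) → Tup m → Tup m → Tup m
    lift2 f u v = tabulate (λ c → f (lookup u c) (lookup v c))

    lift3 : (A → A → A → A) → Tup m → Tup m → Tup m → Tup m
    lift3 f u v w = tabulate (λ c → f (lookup u c) (lookup v c) (lookup w c))

    lift4 : (A → A → A → A → A) → Tup m → Tup m → Tup m → Tup m → Tup m
    lift4 f u v w x = tabulate (λ c → f (lookup u c) (lookup v c) (lookup w c) (lookup x c))

  eval : ∀ {k m} → Term k → (Fin k → Tup m) → Tup m
  eval (var i) r = r i
  eval (tMeet s t) r = lift2 _⊓_ (eval s r) (eval t r)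
  eval (tM s t) r = lift2 opM (eval s r) (eval t r)
  eval (tI s t) r = lift2 opI (eval s r) (eval t r)
  eval (tM' s) r = lift1 opM' (eval s r)
  eval (tH s) r = lift1 opH (eval s r)
  eval (tN0 s t u) r = lift3 opN0 (eval s r) (eval t r) (eval u r)
  eval (tS s t u) r = lift3 opS (eval s r) (eval t r) (eval u r)
  eval (tNd s t u v) r = lift4 opNd (eval s r) (eval t r) (eval u r) (eval v r)
  eval (tP s t u v) r = lift4 opP (eval s r) (eval t r) (eval u r) (eval v r)

  Rel : ℕ → Set₁
  Rel m = Tup m → Set

  record Subuniverse {m : ℕ} (R : Rel m) : Set where
    field
      clMeet : ∀ {u v} → R u → R v → R (lift2 _⊓_ u v)
      clM : ∀ {u v} → R u → R v → R (lift2 opM u v)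
      clM' : ∀ {u} → R u → R (lift1 opM' u)
      clI : ∀ {u v} → R u → R v → R (lift2 opI u v)
      clH : ∀ {u} → R u → R (lift1 opH u)
      clN0 : ∀ {u v w} → R u → R v → R w → R (lift3 opN0 u v w)
      clS : ∀ {u v w} → R u → R v → R w → R (lift3 opS u v w)
      clNd : ∀ {u v w x} → R u → R v → R w → R x → R (lift4 opNd u v w x)
      clP : ∀ {u v w x} → R u → R v → R w → R x → R (lift4 opP u v w x)

  data Gen {m : ℕ} (G : Rel m) : Rel m where
    base : ∀ {u} → G u → Gen G u
    gMeet : ∀ {u v} → Gen G u → Gen G v → Gen G (lift2 _⊓_ u v)
    gM : ∀ {u v} → Gen G u → Gen G v → Gen G (lift2 opM u v)
    gM' : ∀ {u} → Gen G u → Gen G (lift1 opM' u)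
    gI : ∀ {u v} → Gen G u → Gen G v → Gen G (lift2 opI u v)
    gH : ∀ {u} → Gen G u → Gen G (lift1 opH u)
    gN0 : ∀ {u v w} → Gen G u → Gen G v → Gen G w → Gen G (lift3 opN0 u v w)
    gS : ∀ {u v w} → Gen G u → Gen G v → Gen G w → Gen G (lift3 opS u v w)
    gNd : ∀ {u v w x} → Gen G u → Gen G v → Gen G w → Gen G x → Gen G (lift4 opNd u v w x)
    gP : ∀ {u v w x} → Gen G u → Gen G v → Gen G w → Gen G x → Gen G (lift4 opP u v w x)

  InD InX InY : A → Set
  InD x = content x ≡ dot
  InX x = content x ≡ crs
  InY x = ¬ InX x

  AllY : ∀ {m} → Tup m → Set
  AllY r = ∀ c → InY (lookup r c)

  Synchronized : ∀ {m} → Tup m → Set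
  Synchronized r = ∀ c c' → state (lookup r c) ≡ state (lookup r c')

  Computational : ∀ {m} → Rel m → Set
  Computational R = ∀ r → R r →
    Synchronized r × (∀ c c' → InD (lookup r c) → InD (lookup r c') → c ≡ c')

  Halting : ∀ {m} → Rel m → Set
  Halting R = ∃ λ r → R r
    × (∀ c → lookup r c ≡ (zero , zro) ⊎ lookup r c ≡ (zero , dot))
    × ¬ (∀ c → lookup r c ≡ (zero , zro))

  NonHalting : ∀ {m} → Rel m → Set
  NonHalting R = ¬ Halting R

  R_I : ∀ {m} → Rel m → Rel m
  R_I R = Gen (λ x → ∃₂ λ a b → R a × AllY a × R b × AllY b × x ≡ lift2 opI a b)

record StandingAssumptions {n : ℕ} (M : Machine n) : Set where
  field
    clearsRegisters : ∀ t → proj₁ (run M t initial) ≡ zero →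
      proj₁ (proj₂ (run M t initial)) ≡ 0 × proj₂ (proj₂ (run M t initial)) ≡ 0
    firstIsInc : ∃₂ λ R s → M zero ≡ inc R s
    reachFromOne : ∀ i → Star (Edge M) (suc zero) i
    reachZero : ∀ i → Star (Edge M) i zero
    capacity : ∃ λ κ → HaltsWithCapacity M κ
    -- the subalgebra generated by {⟨1,•⟩, ⟨1,0⟩} contains ⟨0,•⟩
    -- (subalgebras of A(M) are identified with subuniverses of A(M)^1)
    genContainsDot0 :
      Alg.Gen M (λ x → x ≡ [ (suc zero , dot) ] ⊎ x ≡ [ (suc zero , zro) ]) [ (zero , dot) ]

module Submission where

-- When the value of a fundamental operation other than M, M′ and
-- I lies in Y^m, it is one of the arguments: for H and N₀ because R contains no
-- halting tuple, for N• because at most one coordinate of a tuple of R is •,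
-- for P because tuples of R are synchronized. A value o of I in Y^m is the
-- generator I(o,o) of R_I. M′ and M preserve both alternatives, except when M
-- combines an I-free x with some y ∈ R_I. Then x and y are companions: they
-- agree except that where one has ⟨i,•⟩ the other has the content read by the
-- instruction of i. If both contain a •, then x is y with two coordinates
-- transposed, and R_I is invariant under this transposition because a
-- generator I(a,b) only depends on where a and b have •. If only one of them
-- contained a •, the two I-generators it yields would pad the subalgebra
-- generated by ⟨1,•⟩, ⟨1,0⟩ into R; as that subalgebra contains ⟨0,•⟩, R would
-- contain a halting tuple.

open import Defs
open import Data.Nat using (ℕ)
open import Data.Fin using (Fin; zero; suc)
open import Data.Fin.Properties using (any?) renaming (_≟_ to _≟F_)
open import Data.Fin.Permutation.Components using (transpose)
open import Data.Bool using (Bool; true; false; if_then_else_; _∧_; not)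
open import Data.Bool.Properties using (∧-conicalˡ; ∧-conicalʳ)
open import Data.Product using (Σ; ∃; _×_; _,_; proj₁; proj₂)
open import Data.Sum using (_⊎_; inj₁; inj₂; [_,_]′)
open import Data.Empty using (⊥-elim)
open import Data.Vec using (Vec; []; lookup; tabulate; [_])
open import Data.Vec.Properties using (lookup∘tabulate; tabulate∘lookup; tabulate-cong)
open import Data.Vec.Relation.Binary.Pointwise.Extensional using (ext; Pointwise-≡⇒≡)
open import Function using (_∘_)
open import Relation.Nullary using (¬_; Dec; yes; no; contradiction)
open import Relation.Binary.PropositionalEquality hiding ([_])
open ≡-Reasoning

tabulate-≡ : ∀ {a} {X : Set a} {m} {f : Fin m → X} {w : Vec X m} →
  (∀ c → f c ≡ lookup w c) → tabulate f ≡ w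
tabulate-≡ {w = w} p = trans (tabulate-cong p) (tabulate∘lookup w)

data TransposeView {m} (i j k : Fin m) : Fin m → Set where
  at-i : k ≡ i → TransposeView i j k j
  at-j : k ≢ i → k ≡ j → TransposeView i j k i
  away : k ≢ i → k ≢ j → TransposeView i j k k

transpose-view : ∀ {m} (i j k : Fin m) → TransposeView i j k (transpose i j k)
transpose-view i j k with k ≟F i
... | yes k≡i = at-i k≡i
... | no k≢i with k ≟F j
...   | yes k≡j = at-j k≢i k≡j
...   | no k≢j = away k≢i k≢j

transpose-at-i : ∀ {m} (i j : Fin m) → transpose i j i ≡ j
transpose-at-i i j with transpose i j i | transpose-view i j i
... | _ | at-i _ = refl
... | _ | at-j i≢i _ = contradiction refl i≢i
... | _ | away i≢i _ = contradiction refl i≢i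

transpose-at-j : ∀ {m} (i j : Fin m) → transpose i j j ≡ i
transpose-at-j i j with transpose i j j | transpose-view i j j
... | _ | at-i j≡i = j≡i
... | _ | at-j _ _ = refl
... | _ | away _ j≢j = contradiction refl j≢j

transpose-hits-i : ∀ {m} {i j k : Fin m} → transpose i j k ≡ i → k ≡ j
transpose-hits-i {i = i} {j} {k} e with transpose i j k | transpose-view i j k
... | _ | at-i k≡i = trans k≡i (sym e)
... | _ | at-j _ k≡j = k≡j
... | _ | away k≢i _ = contradiction e k≢i

transpose-hits-j : ∀ {m} {i j k : Fin m} → transpose i j k ≡ j → k ≡ i
transpose-hits-j {i = i} {j} {k} e with transpose i j k | transpose-view i j k
... | _ | at-i k≡i = k≡i
... | _ | at-j _ k≡j = trans k≡j (sym e)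
... | _ | away _ k≢j = contradiction e k≢j

eqC-sound : ∀ c d → eqC c d ≡ true → c ≡ d
eqC-sound dot dot _ = refl
eqC-sound crs crs _ = refl
eqC-sound zro zro _ = refl
eqC-sound cA cA _ = refl
eqC-sound cB cB _ = refl

module Elements {n : ℕ} (M : Machine n) where
  open Alg M

  eqF-sound : ∀ i j → eqF i j ≡ true → i ≡ j
  eqF-sound i j e with i ≟F j
  ... | yes i≡j = i≡j

  eqA-sound : ∀ a b → eqA a b ≡ true → a ≡ b
  eqA-sound (i , c) (j , d) e
    rewrite eqF-sound i j (∧-conicalˡ _ _ e) | eqC-sound c d (∧-conicalʳ _ _ e) = refl

  InD? : ∀ x → Dec (InD x)
  InD? (_ , dot) = yes refl
  InD? (_ , crs) = no λ ()
  InD? (_ , zro) = no λ ()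
  InD? (_ , cA) = no λ ()
  InD? (_ , cB) = no λ ()

  InD⇒InY : ∀ x → InD x → InY x
  InD⇒InY (_ , dot) refl ()

  isD-sound : ∀ x → isD x ≡ true → InD x
  isD-sound (_ , dot) _ = refl

  isD-true : ∀ x → InD x → isD x ≡ true
  isD-true (_ , dot) refl = refl

  isD-false : ∀ x → ¬ InD x → isD x ≡ false
  isD-false (_ , dot) ¬d = contradiction refl ¬d
  isD-false (_ , crs) _ = refl
  isD-false (_ , zro) _ = refl
  isD-false (_ , cA) _ = refl
  isD-false (_ , cB) _ = refl

  isD-cong : ∀ x y → (InD x → InD y) → (InD y → InD x) → isD x ≡ isD y
  isD-cong x y to from with InD? x | InD? y
  ... | yes dx | yes dy = trans (isD-true x dx) (sym (isD-true y dy))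
  ... | yes dx | no ¬dy = contradiction (to dx) ¬dy
  ... | no ¬dx | yes dy = contradiction (from dy) ¬dx
  ... | no ¬dx | no ¬dy = trans (isD-false x ¬dx) (sym (isD-false y ¬dy))

  dots-equal : ∀ {a b} → state a ≡ state b → InD a → InD b → a ≡ b
  dots-equal {_ , _} {_ , _} refl refl refl = refl

  isX-false : ∀ x → InY x → isX x ≡ false
  isX-false (_ , dot) _ = refl
  isX-false (_ , crs) y = contradiction refl y
  isX-false (_ , zro) _ = refl
  isX-false (_ , cA) _ = refl
  isX-false (_ , cB) _ = refl

  ⊓-inY : ∀ a b → InY (a ⊓ b) → a ⊓ b ≡ a
  ⊓-inY a b h with eqA a b
  ... | true = refl
  ... | false = contradiction refl h

  Halted : A → Set
  Halted x = x ≡ (zero , zro) ⊎ x ≡ (zero , dot)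

  opH-inY : ∀ x → InY (opH x) → Halted x
  opH-inY x h with eqA x (zero , zro) in e₀ | eqA x (zero , dot) in e•
  ... | true | _ = inj₁ (eqA-sound _ _ e₀)
  ... | false | true = inj₂ (eqA-sound _ _ e•)
  ... | false | false = contradiction refl h

  opS-inY : ∀ x y z → InY (opS x y z) → opS x y z ≡ x
  opS-inY x y z h
    with eqA x (one , zro) ∧ eqF (state y) one ∧ eqF (state z) one ∧ okPair (content y) (content z) in e
  ... | true = sym (eqA-sound _ _ (∧-conicalˡ _ _ e))
  ... | false = contradiction refl h

  opN0-inY : ∀ x y z → InY (opN0 x y z) →
    (x ≡ (zero , dot) × opN0 x y z ≡ y) ⊎ (x ≡ (zero , zro) × opN0 x y z ≡ z)
  opN0-inY x y z h with eqA x (zero , dot) ∧ eqF (state y) (state z) in e•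
  ... | true = inj₁ (eqA-sound _ _ (∧-conicalˡ _ _ e•) , refl)
  ... | false with eqA x (zero , zro) ∧ not (isD z) ∧ eqF (state y) (state z) in e₀
  ...   | true = inj₂ (eqA-sound _ _ (∧-conicalˡ _ _ e₀) , refl)
  ...   | false = contradiction refl h

  opNd-inY : ∀ u x y z → InY (opNd u x y z) → opNd u x y z ≡ x ⊎ opNd u x y z ≡ y
  opNd-inY u x y z h with isD u | eqF (state x) (state y) ∧ eqF (state y) (state z)
  ... | _ | false = contradiction refl h
  ... | false | true with eqA x y ∧ not (isX x)
  ...   | true = inj₁ refl
  ...   | false = contradiction refl h
  opNd-inY u x y z h | true | true with eqA x y ∧ not (isX x)
  ...   | true = inj₁ refl
  ...   | false with isX y
  ...     | true = inj₁ refl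
  ...     | false with isX x
  ...       | true = inj₂ refl
  ...       | false with eqA z x in ex
  ...         | true = inj₁ (eqA-sound z x ex)
  ...         | false with eqA z y in ey
  ...           | true = inj₂ (eqA-sound z y ey)
  ...           | false = contradiction refl h

  opNd-undotted : ∀ u x y z → ¬ InD u → InY (opNd u x y z) → opNd u x y z ≡ x × opNd u x y z ≡ y
  opNd-undotted u x y z ¬d h with isD u in eu | eqF (state x) (state y) ∧ eqF (state y) (state z)
  ... | true | _ = contradiction (isD-sound u eu) ¬d
  ... | false | false = contradiction refl h
  ... | false | true with eqA x y ∧ not (isX x) in e
  ...   | true = refl , eqA-sound x y (∧-conicalˡ _ _ e)
  ...   | false = contradiction refl h

  opM'-inY : ∀ x → InY (opM' x) → InY x × opM' (state x , zro) ≡ (state (opM' x) , zro)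
  opM'-inY (zero , c) h = contradiction refl h
  opM'-inY (suc i , c) h with M i
  ... | inc R j = contradiction refl h
  ... | dec rA k j = (λ { refl → h refl }) , refl
  ... | dec rB k j = (λ { refl → h refl }) , refl

  opI-inY : ∀ a b → InY (opI a b) → (InY a × opI a b ≡ opI a a) ⊎ (InY b × opI a b ≡ opI b b)
  opI-inY a (j , d) h with isD a in ea
  ... | true = inj₁ (InD⇒InY a (isD-sound a ea) , refl)
  opI-inY a (j , dot) h | false = contradiction refl h
  opI-inY a (j , crs) h | false = contradiction refl h
  opI-inY a (j , zro) h | false = inj₂ ((λ ()) , refl)
  opI-inY a (j , cA) h | false = inj₂ ((λ ()) , refl)
  opI-inY a (j , cB) h | false = inj₂ ((λ ()) , refl)

  opI-zero : ∀ a b → opI (state a , zro) (state b , zro) ≡ (state (opI a b) , zro)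
  opI-zero a b with isD a | isC b
  ... | true | _ = refl
  ... | false | true = refl
  ... | false | false = refl

  opI-idem : ∀ a b → InY (opI a b) → opI (opI a b) (opI a b) ≡ opI a b
  opI-idem a b h with isD a | isC b
  ... | true | _ = refl
  ... | false | true = refl
  ... | false | false = contradiction refl h

  opI-dotted : ∀ x y → InD x → opI x y ≡ (one , dot)
  opI-dotted x y d rewrite isD-true x d = refl

  opI-undotted : ∀ x y → ¬ InD x → ¬ InD y → InY y → opI x y ≡ (one , zro)
  opI-undotted x y ¬dx ¬dy yy rewrite isD-false x ¬dx | isD-false y ¬dy | isX-false y yy = refl

  opI-cong : ∀ x y x' y' → isD x ≡ isD x' → isD y ≡ isD y' → isX y ≡ isX y' →
    opI x y ≡ opI x' y'
  opI-cong _ _ _ _ ex ey ey' rewrite ex | ey | ey' = refl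

  cueOf : Instr n → Content
  cueOf (inc _ _) = zro
  cueOf (dec R _ _) = creg R

  -- M(⟨i,•⟩, ⟨i,c⟩) is not × exactly when c = cue i; at the halting state the value is arbitrary
  cue : St → Content
  cue zero = zro
  cue (suc i) = cueOf (M i)

  data Companions (w : Content) : A → A → Set where
    equal : ∀ {a} → ¬ InD a → Companions w a a
    dotˡ : ∀ i → Companions w (i , dot) (i , w)
    dotʳ : ∀ i → Companions w (i , w) (i , dot)

  companions-flip : ∀ {a b} → Companions (cue (state a)) a b → Companions (cue (state b)) b a
  companions-flip (equal ¬d) = equal ¬d
  companions-flip (dotˡ i) = dotʳ i
  companions-flip (dotʳ i) = dotˡ i

  companions-state : ∀ {w a b} → Companions w a b → state a ≡ state b
  companions-state (equal _) = refl
  companions-state (dotˡ _) = refl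
  companions-state (dotʳ _) = refl

  companion-of-dotˡ : ∀ {w a b} → Companions w a b → InD a → b ≡ (state a , w)
  companion-of-dotˡ (equal ¬d) d = contradiction d ¬d
  companion-of-dotˡ (dotˡ _) _ = refl
  companion-of-dotˡ (dotʳ _) refl = refl

  companion-of-dotʳ : ∀ {w a b} → Companions w a b → InD b → a ≡ (state b , w)
  companion-of-dotʳ (equal ¬d) d = contradiction d ¬d
  companion-of-dotʳ (dotˡ _) refl = refl
  companion-of-dotʳ (dotʳ _) _ = refl

  companions-undotted : ∀ {w a b} → Companions w a b → ¬ InD a → ¬ InD b → a ≡ b
  companions-undotted (equal _) _ _ = refl
  companions-undotted (dotˡ _) ¬da _ = contradiction refl ¬da
  companions-undotted (dotʳ _) _ ¬db = contradiction refl ¬db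

  -- the absurd crs/crs clauses only steer the coverage checker into splitting c
  Mc-companions : ∀ ι i c d → eqC (Mc ι c d) crs ≡ false →
    InY (i , c) × InY (i , d) × Companions (cueOf ι) (i , c) (i , d)
  Mc-companions (inc R j) i crs crs ()
  Mc-companions (inc R j) i dot zro _ = (λ ()) , (λ ()) , dotˡ i
  Mc-companions (inc R j) i zro dot _ = (λ ()) , (λ ()) , dotʳ i
  Mc-companions (inc R j) i zro zro _ = (λ ()) , (λ ()) , equal (λ ())
  Mc-companions (inc R j) i cA cA _ = (λ ()) , (λ ()) , equal (λ ())
  Mc-companions (inc R j) i cB cB _ = (λ ()) , (λ ()) , equal (λ ())
  Mc-companions (dec rA k j) i crs crs ()
  Mc-companions (dec rA k j) i dot cA _ = (λ ()) , (λ ()) , dotˡ i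
  Mc-companions (dec rA k j) i cA dot _ = (λ ()) , (λ ()) , dotʳ i
  Mc-companions (dec rA k j) i zro zro _ = (λ ()) , (λ ()) , equal (λ ())
  Mc-companions (dec rA k j) i cA cA _ = (λ ()) , (λ ()) , equal (λ ())
  Mc-companions (dec rA k j) i cB cB _ = (λ ()) , (λ ()) , equal (λ ())
  Mc-companions (dec rB k j) i crs crs ()
  Mc-companions (dec rB k j) i dot cB _ = (λ ()) , (λ ()) , dotˡ i
  Mc-companions (dec rB k j) i cB dot _ = (λ ()) , (λ ()) , dotʳ i
  Mc-companions (dec rB k j) i zro zro _ = (λ ()) , (λ ()) , equal (λ ())
  Mc-companions (dec rB k j) i cA cA _ = (λ ()) , (λ ()) , equal (λ ())
  Mc-companions (dec rB k j) i cB cB _ = (λ ()) , (λ ()) , equal (λ ())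

  Mc-zero : ∀ ι → Mc ι zro zro ≡ zro
  Mc-zero (inc _ _) = refl
  Mc-zero (dec rA _ _) = refl
  Mc-zero (dec rB _ _) = refl

  opM-inY : ∀ a b → InY (opM a b) → InY a × InY b × Companions (cue (state a)) a b
  opM-inY (i , c) (j , d) h with eqF i j in e
  ... | false = contradiction refl h
  ... | true with eqF-sound i j e
  ...   | refl with i
  ...     | zero = contradiction refl h
  ...     | suc i₀ = Mc-companions (M i₀) (suc i₀) c d (isX-false (nxt (M i₀) , Mc (M i₀) c d) h)

  opM-zero : ∀ a b → InY (opM a b) → opM (state a , zro) (state b , zro) ≡ (state (opM a b) , zro)
  opM-zero (i , c) (j , d) h with eqF i j in e
  ... | false = contradiction refl h
  ... | true with eqF-sound i j e
  ...   | refl with i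
  ...     | zero = contradiction refl h
  ...     | suc i₀ = cong (nxt (M i₀) ,_) (Mc-zero (M i₀))

module Tuples {n : ℕ} (M : Machine n) where
  open Alg M
  open Elements M

  allY-tabulate : ∀ {m} {g : Fin m → A} → AllY (tabulate g) → ∀ c → InY (g c)
  allY-tabulate {g = g} y c = subst InY (lookup∘tabulate g c) (y c)

  Gen-least : ∀ {m} {G P : Rel m} → Subuniverse P → (∀ {u} → G u → P u) →
    ∀ {u} → Gen G u → P u
  Gen-least {G = G} {P} closed G⊆P = go
    where
      open Subuniverse closed
      go : ∀ {u} → Gen G u → P u
      go (base g) = G⊆P g
      go (gMeet p q) = clMeet (go p) (go q)
      go (gM p q) = clM (go p) (go q)
      go (gM' p) = clM' (go p)
      go (gI p q) = clI (go p) (go q)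
      go (gH p) = clH (go p)
      go (gN0 p q s) = clN0 (go p) (go q) (go s)
      go (gS p q s) = clS (go p) (go q) (go s)
      go (gNd p q s t) = clNd (go p) (go q) (go s) (go t)
      go (gP p q s t) = clP (go p) (go q) (go s) (go t)

  reindex : ∀ {m m'} → (Fin m' → Fin m) → Tup m → Tup m'
  reindex τ u = tabulate λ c → lookup u (τ c)

  module _ {m m'} (τ : Fin m' → Fin m) where
    private
      at : ∀ (u : Tup m) c → lookup (reindex τ u) c ≡ lookup u (τ c)
      at u c = lookup∘tabulate _ c

    reindex-lift1 : ∀ f u → reindex τ (lift1 f u) ≡ lift1 f (reindex τ u)
    reindex-lift1 f u = tabulate-cong λ c →
      trans (lookup∘tabulate _ (τ c)) (sym (cong f (at u c)))

    reindex-lift2 : ∀ f u v → reindex τ (lift2 f u v) ≡ lift2 f (reindex τ u) (reindex τ v)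
    reindex-lift2 f u v = tabulate-cong λ c →
      trans (lookup∘tabulate _ (τ c)) (sym (cong₂ f (at u c) (at v c)))

    reindex-lift3 : ∀ f u v w →
      reindex τ (lift3 f u v w) ≡ lift3 f (reindex τ u) (reindex τ v) (reindex τ w)
    reindex-lift3 f u v w = tabulate-cong λ c →
      trans (lookup∘tabulate _ (τ c))
        (sym (cong₂ (λ (a , b) → f a b) (cong₂ _,_ (at u c) (at v c)) (at w c)))

    reindex-lift4 : ∀ f u v w x →
      reindex τ (lift4 f u v w x) ≡ lift4 f (reindex τ u) (reindex τ v) (reindex τ w) (reindex τ x)
    reindex-lift4 f u v w x = tabulate-cong λ c →
      trans (lookup∘tabulate _ (τ c))
        (sym (cong₂ (λ (a , b) (d , e) → f a b d e)
          (cong₂ _,_ (at u c) (at v c)) (cong₂ _,_ (at w c) (at x c))))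

    Gen-reindex : ∀ {G : Rel m} {G' : Rel m'} → (∀ {u} → G u → Gen G' (reindex τ u)) →
      ∀ {u} → Gen G u → Gen G' (reindex τ u)
    Gen-reindex {G' = G'} = Gen-least record
      { clMeet = λ {u} {v} p q → along (reindex-lift2 _⊓_ u v) (gMeet p q)
      ; clM = λ {u} {v} p q → along (reindex-lift2 opM u v) (gM p q)
      ; clM' = λ {u} p → along (reindex-lift1 opM' u) (gM' p)
      ; clI = λ {u} {v} p q → along (reindex-lift2 opI u v) (gI p q)
      ; clH = λ {u} p → along (reindex-lift1 opH u) (gH p)
      ; clN0 = λ {u} {v} {w} p q s → along (reindex-lift3 opN0 u v w) (gN0 p q s)
      ; clS = λ {u} {v} {w} p q s → along (reindex-lift3 opS u v w) (gS p q s)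
      ; clNd = λ {u} {v} {w} {x} p q s t → along (reindex-lift4 opNd u v w x) (gNd p q s t)
      ; clP = λ {u} {v} {w} {x} p q s t → along (reindex-lift4 opP u v w x) (gP p q s t)
      }
      where
        along : ∀ {u v} → u ≡ v → Gen G' v → Gen G' u
        along e = subst (Gen G') (sym e)

  module Padding {m : ℕ} (c₀ : Fin m) where
    padAt : Fin m → A → A
    padAt c α with c ≟F c₀
    ... | yes _ = α
    ... | no _ = state α , zro

    pad : A → Tup m
    pad α = tabulate λ c → padAt c α

    lookup-pad : ∀ α c → lookup (pad α) c ≡ padAt c α
    lookup-pad α c = lookup∘tabulate _ c

    padAt-c₀ : ∀ α → padAt c₀ α ≡ α
    padAt-c₀ α with c₀ ≟F c₀
    ... | yes _ = refl
    ... | no c₀≢c₀ = contradiction refl c₀≢c₀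

    padAt-zro : ∀ c i → padAt c (i , zro) ≡ (i , zro)
    padAt-zro c i with c ≟F c₀
    ... | yes _ = refl
    ... | no _ = refl

    pad-lift1 : ∀ f a → f (state a , zro) ≡ (state (f a) , zro) → lift1 f (pad a) ≡ pad (f a)
    pad-lift1 f a e = tabulate-cong λ c → trans (cong f (lookup-pad a c)) (commutes c)
      where
        commutes : ∀ c → f (padAt c a) ≡ padAt c (f a)
        commutes c with c ≟F c₀
        ... | yes _ = refl
        ... | no _ = e

    pad-lift2 : ∀ f a b → f (state a , zro) (state b , zro) ≡ (state (f a b) , zro) →
      lift2 f (pad a) (pad b) ≡ pad (f a b)
    pad-lift2 f a b e =
      tabulate-cong λ c → trans (cong₂ f (lookup-pad a c) (lookup-pad b c)) (commutes c)
      where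
        commutes : ∀ c → f (padAt c a) (padAt c b) ≡ padAt c (f a b)
        commutes c with c ≟F c₀
        ... | yes _ = refl
        ... | no _ = e

  ⊓-collapse : ∀ {m} (x y : Tup m) → AllY (lift2 _⊓_ x y) → lift2 _⊓_ x y ≡ x
  ⊓-collapse x y Y = tabulate-≡ λ c → ⊓-inY (lookup x c) (lookup y c) (allY-tabulate Y c)

  opS-collapse : ∀ {m} (x y z : Tup m) → AllY (lift3 opS x y z) → lift3 opS x y z ≡ x
  opS-collapse x y z Y =
    tabulate-≡ λ c → opS-inY (lookup x c) (lookup y c) (lookup z c) (allY-tabulate Y c)

  opP-collapse : ∀ {m} (u v x y : Tup m) → Synchronized u → Synchronized v →
    lift4 opP u v x y ≡ x ⊎ lift4 opP u v x y ≡ y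
  opP-collapse {ℕ.zero} u v [] y _ _ = inj₁ refl
  opP-collapse {ℕ.suc _} u v x y su sv = choose (compares zero) refl
    where
      compares : Fin _ → Bool
      compares c = eqF (state (lookup u c)) (state (lookup v c))
      selects : ∀ {b} c → compares zero ≡ b →
        opP (lookup u c) (lookup v c) (lookup x c) (lookup y c) ≡ (if b then lookup x c else lookup y c)
      selects c e =
        cong (λ b → if b then lookup x c else lookup y c) (trans (cong₂ eqF (su c zero) (sv c zero)) e)
      choose : ∀ b → compares zero ≡ b → lift4 opP u v x y ≡ x ⊎ lift4 opP u v x y ≡ y
      choose true e = inj₁ (tabulate-≡ λ c → selects c e)
      choose false e = inj₂ (tabulate-≡ λ c → selects c e)

module NonHaltingRelation {n : ℕ} (M : Machine n)
  (dot₀-generated :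
    Alg.Gen M (λ x → x ≡ [ (suc zero , dot) ] ⊎ x ≡ [ (suc zero , zro) ]) [ (zero , dot) ])
  {m : ℕ} (R : Alg.Rel M m) (sub : Alg.Subuniverse M R) (cp : Alg.Computational M R)
  (nh : Alg.NonHalting M R) where
  open Alg M
  open Elements M
  open Tuples M
  open Subuniverse sub

  synchronized : ∀ {a} → R a → Synchronized a
  synchronized {a} Ra = proj₁ (cp a Ra)

  dot-unique : ∀ {a} → R a → ∀ {c c'} → InD (lookup a c) → InD (lookup a c') → c ≡ c'
  dot-unique {a} Ra = proj₂ (cp a Ra) _ _

  HasDot : Tup m → Set
  HasDot u = ∃ λ c → InD (lookup u c)

  hasDot? : ∀ u → Dec (HasDot u)
  hasDot? u = any? λ c → InD? (lookup u c)

  halted⇒zero : ∀ {x} → R x → (∀ c → Halted (lookup x c)) → ∀ c → lookup x c ≡ (zero , zro)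
  halted⇒zero {x} Rx halted c with halted c
  ... | inj₁ e = e
  ... | inj₂ e = ⊥-elim (nh (x , Rx , halted , λ zeros → contradiction (trans (sym e) (zeros c)) λ ()))

  module _ (c₀ : Fin m) where
    open Padding c₀

    Padded : A → Set
    Padded α = InY α → R (pad α)

    padded-by : ∀ {o a} → (InY o → o ≡ a) → Padded a → Padded o
    padded-by select pa h = subst (R ∘ pad) (sym (select h)) (pa (subst InY (select h) h))

    padded-by₂ : ∀ {o a b} → (InY o → o ≡ a ⊎ o ≡ b) → Padded a → Padded b → Padded o
    padded-by₂ select pa pb h with select h
    ... | inj₁ e = padded-by (λ _ → e) pa h
    ... | inj₂ e = padded-by (λ _ → e) pb h

    padded-M : ∀ a b → Padded a → Padded b → Padded (opM a b)
    padded-M a b pa pb h with opM-inY a b h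
    ... | ya , yb , _ = subst R (pad-lift2 opM a b (opM-zero a b h)) (clM (pa ya) (pb yb))

    padded-M' : ∀ a → Padded a → Padded (opM' a)
    padded-M' a pa h with opM'-inY a h
    ... | ya , e = subst R (pad-lift1 opM' a e) (clM' (pa ya))

    padded-I-diagonal : ∀ a → Padded a → InY a → R (pad (opI a a))
    padded-I-diagonal a pa ya = subst R (pad-lift2 opI a a (opI-zero a a)) (clI (pa ya) (pa ya))

    padded-I : ∀ a b → Padded a → Padded b → Padded (opI a b)
    padded-I a b pa pb h with opI-inY a b h
    ... | inj₁ (ya , e) = subst (R ∘ pad) (sym e) (padded-I-diagonal a pa ya)
    ... | inj₂ (yb , e) = subst (R ∘ pad) (sym e) (padded-I-diagonal b pb yb)

    padded-H : ∀ a → Padded a → Padded (opH a)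
    padded-H a pa h with opH-inY a h
    ... | inj₁ refl = subst R (pad-lift1 opH a refl) (clH (pa λ ()))
    ... | inj₂ refl = subst R (pad-lift1 opH a refl) (clH (pa λ ()))

    padded-P : ∀ u v x y → Padded x → Padded y → Padded (opP u v x y)
    padded-P u v x y px py with eqF (state u) (state v)
    ... | true = px
    ... | false = py

    padded-subuniverse : Subuniverse {1} (λ e → Padded (lookup e zero))
    padded-subuniverse = record
      { clMeet = λ {u} {v} pa _ → padded-by (⊓-inY (lookup u zero) (lookup v zero)) pa
      ; clM = λ pa pb → padded-M _ _ pa pb
      ; clM' = λ pa → padded-M' _ pa
      ; clI = λ pa pb → padded-I _ _ pa pb
      ; clH = λ pa → padded-H _ pa
      ; clN0 = λ {x} {y} {z} _ py pz → padded-by₂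
          ([ inj₁ ∘ proj₂ , inj₂ ∘ proj₂ ]′ ∘ opN0-inY (lookup x zero) (lookup y zero) (lookup z zero))
          py pz
      ; clS = λ {x} {y} {z} px _ _ → padded-by (opS-inY (lookup x zero) (lookup y zero) (lookup z zero)) px
      ; clNd = λ {u} {x} {y} {z} _ px py _ →
          padded-by₂ (opNd-inY (lookup u zero) (lookup x zero) (lookup y zero) (lookup z zero)) px py
      ; clP = λ {u} {v} {x} {y} _ _ px py →
          padded-P (lookup u zero) (lookup v zero) (lookup x zero) (lookup y zero) px py
      }

    halting-if-padded-generators : R (pad (one , dot)) → R (pad (one , zro)) → Halting R
    halting-if-padded-generators R• R₀ = pad (zero , dot) , R-pad , halted , not-all-zero
      where
        R-pad : R (pad (zero , dot))
        R-pad = Gen-least padded-subuniverse generators dot₀-generated λ ()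
          where
            generators : ∀ {e} → e ≡ [ (one , dot) ] ⊎ e ≡ [ (one , zro) ] → Padded (lookup e zero)
            generators (inj₁ refl) _ = R•
            generators (inj₂ refl) _ = R₀
        halted : ∀ c → Halted (lookup (pad (zero , dot)) c)
        halted c rewrite lookup-pad (zero , dot) c with c ≟F c₀
        ... | yes _ = inj₂ refl
        ... | no _ = inj₁ refl
        not-all-zero : ¬ (∀ c → lookup (pad (zero , dot)) c ≡ (zero , zro))
        not-all-zero zeros =
          contradiction (trans (sym (trans (lookup-pad _ c₀) (padAt-c₀ _))) (zeros c₀)) λ ()

  dot-transfer : ∀ {a b} → R a → AllY a → R b → AllY b → HasDot a → HasDot b
  dot-transfer {a} {b} Ra Ya Rb Yb (c₀ , d₀) with hasDot? b
  ... | yes found = found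
  ... | no ¬dot =
    ⊥-elim (nh (halting-if-padded-generators c₀ (subst R I-ab (clI Ra Rb)) (subst R I-bb (clI Rb Rb))))
    where
      open Padding c₀
      I-ab : lift2 opI a b ≡ pad (one , dot)
      I-ab = tabulate-cong at
        where
          at : ∀ c → opI (lookup a c) (lookup b c) ≡ padAt c (one , dot)
          at c with c ≟F c₀
          ... | yes refl = opI-dotted (lookup a c) (lookup b c) d₀
          ... | no c≢c₀ =
            opI-undotted (lookup a c) (lookup b c) (c≢c₀ ∘ λ d → dot-unique Ra d d₀) (¬dot ∘ (c ,_)) (Yb c)
      I-bb : lift2 opI b b ≡ pad (one , zro)
      I-bb = tabulate-cong λ c → trans
        (opI-undotted (lookup b c) (lookup b c) (¬dot ∘ (c ,_)) (¬dot ∘ (c ,_)) (Yb c))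
        (sym (padAt-zro c one))

  subst-dot : ∀ (u : Tup m) {c c'} → c ≡ c' → InD (lookup u c) → InD (lookup u c')
  subst-dot u = subst (InD ∘ lookup u)

  DotPatternsStable : (Fin m → Fin m) → Set
  DotPatternsStable τ = ∀ {a} → R a → AllY a →
    ∃ λ a' → R a' × AllY a' × (∀ c → isD (lookup a' c) ≡ isD (lookup a (τ c)))

  RI-reindex : ∀ τ → DotPatternsStable τ → ∀ {u} → R_I R u → R_I R (reindex τ u)
  RI-reindex τ stable = Gen-reindex τ generator
    where
      generator : ∀ {u} → (∃ λ a → ∃ λ b → R a × AllY a × R b × AllY b × u ≡ lift2 opI a b) →
        R_I R (reindex τ u)
      generator (a , b , Ra , Ya , Rb , Yb , refl) with stable Ra Ya | stable Rb Yb
      ... | a' , Ra' , Ya' , sa | b' , Rb' , Yb' , sb =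
        base (a' , b' , Ra' , Ya' , Rb' , Yb' , tabulate-cong λ c → trans (lookup∘tabulate _ (τ c))
          (opI-cong (lookup a (τ c)) (lookup b (τ c)) (lookup a' c) (lookup b' c) (sym (sa c)) (sym (sb c))
            (trans (isX-false (lookup b (τ c)) (Yb (τ c))) (sym (isX-false (lookup b' c) (Yb' c))))))

  same-dots-along : ∀ (τ : Fin m → Fin m) {a a' : Tup m} {d d' : Fin m} →
    R a → InD (lookup a d) → R a' → InD (lookup a' d') → τ d' ≡ d → (∀ {c} → τ c ≡ d → c ≡ d') →
    ∀ c → isD (lookup a' c) ≡ isD (lookup a (τ c))
  same-dots-along τ {a} {a'} Ra da Ra' da' τd'≡d τ⁻¹d c = isD-cong (lookup a' c) (lookup a (τ c))
    (λ dc → subst-dot a (sym (trans (cong τ (dot-unique Ra' dc da')) τd'≡d)) da)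
    (λ dτc → subst-dot a' (sym (τ⁻¹d (dot-unique Ra dτc da))) da')

  transpose-stable : ∀ {p q i j} → R p → AllY p → InD (lookup p i) → R q → AllY q → InD (lookup q j) →
    DotPatternsStable (transpose i j)
  transpose-stable {p} {q} {i} {j} Rp Yp dp Rq Yq dq {a} Ra Ya with InD? (lookup a i) | InD? (lookup a j)
  ... | yes dai | _ =
    q , Rq , Yq , same-dots-along (transpose i j) Ra dai Rq dq (transpose-at-j i j) transpose-hits-i
  ... | no _ | yes daj =
    p , Rp , Yp , same-dots-along (transpose i j) Ra daj Rp dp (transpose-at-i i j) transpose-hits-j
  ... | no ¬dai | no ¬daj = a , Ra , Ya , λ c → fixed (transpose-view i j c)
    where
      fixed : ∀ {c c'} → TransposeView i j c c' → isD (lookup a c) ≡ isD (lookup a c')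
      fixed (at-i refl) = trans (isD-false (lookup a i) ¬dai) (sym (isD-false (lookup a j) ¬daj))
      fixed (at-j _ refl) = trans (isD-false (lookup a j) ¬daj) (sym (isD-false (lookup a i) ¬dai))
      fixed (away _ _) = refl

  RI-companion : ∀ {x y} → R x → AllY x → R y → AllY y →
    (∀ c → Companions (cue (state (lookup x c))) (lookup x c) (lookup y c)) → R_I R x → R_I R y
  RI-companion {x} {y} Rx Yx Ry Yy comp g with hasDot? x
  ... | no ¬dot = subst (R_I R) (Pointwise-≡⇒≡ (ext λ c →
        companions-undotted (comp c) (¬dot ∘ (c ,_)) (¬dot ∘ dot-transfer Ry Yy Rx Yx ∘ (c ,_)))) g
  ... | yes (c₀ , d₀) with dot-transfer Rx Yx Ry Yy (c₀ , d₀)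
  ...   | c₁ , d₁ = subst (R_I R) (tabulate-≡ λ c → moved (transpose-view c₁ c₀ c))
                      (RI-reindex (transpose c₁ c₀) (transpose-stable Ry Yy d₁ Rx Yx d₀) g)
    where
      dots-agree : lookup x c₀ ≡ lookup y c₁
      dots-agree = dots-equal
        (trans (synchronized Rx c₀ c₁) (companions-state (comp c₁))) d₀ d₁
      cues-agree : lookup x c₁ ≡ lookup y c₀
      cues-agree = begin
        lookup x c₁                                        ≡⟨ companion-of-dotʳ (comp c₁) d₁ ⟩
        (state (lookup y c₁) , cue (state (lookup x c₁)))  ≡⟨ cong (_, _) (sym (companions-state (comp c₁))) ⟩
        (state (lookup x c₁) , cue (state (lookup x c₁)))  ≡⟨ cong (λ s → s , cue s) (synchronized Rx c₁ c₀) ⟩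
        (state (lookup x c₀) , cue (state (lookup x c₀)))  ≡⟨ companion-of-dotˡ (comp c₀) d₀ ⟨
        lookup y c₀                                        ∎
      moved : ∀ {c c'} → TransposeView c₁ c₀ c c' → lookup x c' ≡ lookup y c
      moved (at-i refl) = dots-agree
      moved (at-j _ refl) = cues-agree
      moved (away c≢c₁ c≢c₀) = companions-undotted (comp _)
        (c≢c₀ ∘ λ d → dot-unique Rx d d₀) (c≢c₁ ∘ λ d → dot-unique Ry d d₁)

  opH-collapse : ∀ x → R x → AllY (lift1 opH x) → lift1 opH x ≡ x
  opH-collapse x Rx Y = tabulate-≡ λ c → trans (cong opH (zeros c)) (sym (zeros c))
    where
      zeros : ∀ c → lookup x c ≡ (zero , zro)
      zeros = halted⇒zero Rx λ c → opH-inY (lookup x c) (allY-tabulate Y c)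

  opN0-collapse : ∀ x y z → R x → AllY (lift3 opN0 x y z) → lift3 opN0 x y z ≡ z
  opN0-collapse x y z Rx Y = tabulate-≡ selects-z
    where
      N0 : Fin m → A
      N0 c = opN0 (lookup x c) (lookup y c) (lookup z c)
      cases : ∀ c → (lookup x c ≡ (zero , dot) × N0 c ≡ lookup y c)
                  ⊎ (lookup x c ≡ (zero , zro) × N0 c ≡ lookup z c)
      cases c = opN0-inY (lookup x c) (lookup y c) (lookup z c) (allY-tabulate Y c)
      zeros : ∀ c → lookup x c ≡ (zero , zro)
      zeros = halted⇒zero Rx λ c → [ inj₂ ∘ proj₁ , inj₁ ∘ proj₁ ]′ (cases c)
      selects-z : ∀ c → N0 c ≡ lookup z c
      selects-z c with cases c
      ... | inj₁ (x≡0• , _) = contradiction (trans (sym x≡0•) (zeros c)) λ ()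
      ... | inj₂ (_ , e) = e

  opNd-collapse : ∀ u x y z → R u → AllY (lift4 opNd u x y z) →
    lift4 opNd u x y z ≡ x ⊎ lift4 opNd u x y z ≡ y
  opNd-collapse u x y z Ru Y = choose (hasDot? u)
    where
      Nd : Fin m → A
      Nd c = opNd (lookup u c) (lookup x c) (lookup y c) (lookup z c)

      undotted-at : ∀ c → ¬ InD (lookup u c) → Nd c ≡ lookup x c × Nd c ≡ lookup y c
      undotted-at c ¬d =
        opNd-undotted (lookup u c) (lookup x c) (lookup y c) (lookup z c) ¬d (allY-tabulate Y c)

      agrees : ∀ {c₀} → InD (lookup u c₀) → ∀ t →
        (∀ {c} → Nd c ≡ lookup x c × Nd c ≡ lookup y c → Nd c ≡ lookup t c) →
        Nd c₀ ≡ lookup t c₀ → lift4 opNd u x y z ≡ t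
      agrees {c₀} d₀ t pick at-c₀ = tabulate-≡ at
        where
          at : ∀ c → Nd c ≡ lookup t c
          at c with c ≟F c₀
          ... | yes refl = at-c₀
          ... | no c≢c₀ = pick (undotted-at c (c≢c₀ ∘ λ d → dot-unique Ru d d₀))

      choose : Dec (HasDot u) → lift4 opNd u x y z ≡ x ⊎ lift4 opNd u x y z ≡ y
      choose (no ¬dot) = inj₁ (tabulate-≡ λ c → proj₁ (undotted-at c (¬dot ∘ (c ,_))))
      choose (yes (c₀ , d₀))
        with opNd-inY (lookup u c₀) (lookup x c₀) (lookup y c₀) (lookup z c₀) (allY-tabulate Y c₀)
      ... | inj₁ e = inj₁ (agrees d₀ x proj₁ e)
      ... | inj₂ e = inj₂ (agrees d₀ y proj₂ e)

  module _ {k : ℕ} (r : Fin k → Tup m) (rR : ∀ i → R (r i)) where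
    eval-R : ∀ t → R (eval t r)
    eval-R (var i) = rR i
    eval-R (tMeet s t) = clMeet (eval-R s) (eval-R t)
    eval-R (tM s t) = clM (eval-R s) (eval-R t)
    eval-R (tI s t) = clI (eval-R s) (eval-R t)
    eval-R (tM' s) = clM' (eval-R s)
    eval-R (tH s) = clH (eval-R s)
    eval-R (tN0 s t u) = clN0 (eval-R s) (eval-R t) (eval-R u)
    eval-R (tS s t u) = clS (eval-R s) (eval-R t) (eval-R u)
    eval-R (tNd s t u v) = clNd (eval-R s) (eval-R t) (eval-R u) (eval-R v)
    eval-R (tP s t u v) = clP (eval-R s) (eval-R t) (eval-R u) (eval-R v)

    Dichotomy : Tup m → Set
    Dichotomy v = R_I R v ⊎ Σ (Term k) (λ s → NoI s × eval s r ≡ v)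

    collapses-to : ∀ {u v} → u ≡ v → AllY u → (AllY v → Dichotomy v) → Dichotomy u
    collapses-to e Y k = subst Dichotomy (sym e) (k (subst AllY e Y))

    dichotomy : ∀ t → AllY (eval t r) → Dichotomy (eval t r)
    dichotomy (var i) _ = inj₂ (var i , nVar i , refl)
    dichotomy (tMeet a b) Y = collapses-to (⊓-collapse (eval a r) (eval b r) Y) Y (dichotomy a)
    dichotomy (tH a) Y = collapses-to (opH-collapse (eval a r) (eval-R a) Y) Y (dichotomy a)
    dichotomy (tS a b c) Y = collapses-to (opS-collapse (eval a r) (eval b r) (eval c r) Y) Y (dichotomy a)
    dichotomy (tN0 a b c) Y = collapses-to (opN0-collapse (eval a r) (eval b r) (eval c r) (eval-R a) Y) Y (dichotomy c)
    dichotomy (tNd a b c d) Y with opNd-collapse (eval a r) (eval b r) (eval c r) (eval d r) (eval-R a) Y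
    ... | inj₁ e = collapses-to e Y (dichotomy b)
    ... | inj₂ e = collapses-to e Y (dichotomy c)
    dichotomy (tP a b c d) Y
      with opP-collapse (eval a r) (eval b r) (eval c r) (eval d r)
             (synchronized (eval-R a)) (synchronized (eval-R b))
    ... | inj₁ e = collapses-to e Y (dichotomy c)
    ... | inj₂ e = collapses-to e Y (dichotomy d)
    dichotomy (tM' a) Y with dichotomy a (λ c → proj₁ (opM'-inY (lookup (eval a r) c) (allY-tabulate Y c)))
    ... | inj₁ g = inj₁ (gM' g)
    ... | inj₂ (s , ns , e) = inj₂ (tM' s , nM' ns , cong (lift1 opM') e)
    dichotomy (tI a b) Y =
      inj₁ (base (o , o , eval-R (tI a b) , Y , eval-R (tI a b) , Y , sym (tabulate-≡ idem)))
      where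
        o : Tup m
        o = eval (tI a b) r
        idem : ∀ c → opI (lookup o c) (lookup o c) ≡ lookup o c
        idem c rewrite lookup∘tabulate (λ c → opI (lookup (eval a r) c) (lookup (eval b r) c)) c =
          opI-idem (lookup (eval a r) c) (lookup (eval b r) c) (allY-tabulate Y c)
    dichotomy (tM a b) Y = combine (dichotomy a Yx) (dichotomy b Yy)
      where
        x y : Tup m
        x = eval a r
        y = eval b r
        parts : ∀ c → InY (lookup x c) × InY (lookup y c) ×
          Companions (cue (state (lookup x c))) (lookup x c) (lookup y c)
        parts c = opM-inY (lookup x c) (lookup y c) (allY-tabulate Y c)
        Yx : AllY x
        Yx = proj₁ ∘ parts
        Yy : AllY y
        Yy = proj₁ ∘ proj₂ ∘ parts
        comp : ∀ c → Companions (cue (state (lookup x c))) (lookup x c) (lookup y c)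
        comp = proj₂ ∘ proj₂ ∘ parts
        combine : Dichotomy x → Dichotomy y → Dichotomy (lift2 opM x y)
        combine (inj₁ gx) (inj₁ gy) = inj₁ (gM gx gy)
        combine (inj₁ gx) (inj₂ _) = inj₁ (gM gx (RI-companion (eval-R a) Yx (eval-R b) Yy comp gx))
        combine (inj₂ _) (inj₁ gy) =
          inj₁ (gM (RI-companion (eval-R b) Yy (eval-R a) Yx (companions-flip ∘ comp) gy) gy)
        combine (inj₂ (s , ns , es)) (inj₂ (s' , ns' , es')) =
          inj₂ (tM s s' , nM ns ns' , cong₂ (lift2 opM) es es')

proposition7p11 : ∀ {n : ℕ} (M : Machine n) → StandingAssumptions M →
    ∀ {m : ℕ} (R : Alg.Rel M m) → Alg.Subuniverse M R → Alg.Computational M R →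
    Alg.NonHalting M R →
    ∀ {k : ℕ} (t : Term k) (r : Fin k → Alg.Tup M m) → (∀ i → R (r i)) →
    Alg.AllY M (Alg.eval M t r) →
    Alg.R_I M R (Alg.eval M t r)
      ⊎ Σ (Term k) (λ s → NoI s × Alg.eval M s r ≡ Alg.eval M t r)
proposition7p11 M SA R sub cp nh t r rR =
  NonHaltingRelation.dichotomy M (StandingAssumptions.genContainsDot0 SA) R sub cp nh r rR t
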